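{- Let $n,t$ be positive integers, let $s_1,\dots,s_n$ be positive integers (not necessarily distinct), and let $A(x)=\prod_{i=1}^n (1+x^{s_i})\in\mathbb{Z}[x]$. Suppose $[x^t]A(x)\neq 0$, and let $p$ be a prime chosen uniformly at random among the primes in the interval $[t+1,(n+t)^3]$. Then, with probability $1-O((n+t)^{ -1})$, $p$ does not divide $[x^t]A(x)$. (Here the constant implied by the $O$-notation is absolute, independent of $n$, $t$ and $s_1,\dots,s_n$.)
   Context: For a polynomial or formal power series $f(x)$, $[x^i]f(x)$ denotes the coefficient of $x^i$ in $f(x)$. Thus $[x^t]A(x)$ equals the number of index sets $I\subseteq\{1,\dots,n\}$ with $\sum_{i\in I}s_i=t$. -}

module Defs where

open import Data.Nat using (ℕ; zero; suc; _+_; _∸_; _≤?_)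
open import Data.Nat.Primality using (Prime; prime?)
open import Data.Nat.Divisibility using (_∣_; _∣?_)
open import Data.List using (List; []; _∷_; length; filter; applyUpTo)
open import Data.Vec using (Vec; []; _∷_)
open import Data.Product using (_×_)
open import Relation.Nullary using (yes; no)
open import Relation.Nullary.Decidable using (_×-dec_)

-- Coefficient [x^t] of A(x) = ∏_{i} (1 + x^{s_i}) ∈ ℤ[x], computed by literally
-- expanding the product: [x^t] (1 + x^s) B(x) = [x^t] B(x) + [x^{t-s}] B(x)
-- (second term only when s ≤ t); the empty product is the polynomial 1.
-- All coefficients are non-negative so ℕ suffices.
coeffA : ∀ {n} → Vec ℕ n → ℕ → ℕ
coeffA [] zero = 1
coeffA [] (suc _) = 0
coeffA (s ∷ ss) t with s ≤? t
... | yes _ = coeffA ss t + coeffA ss (t ∸ s)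
... | no _  = coeffA ss t

interval : ℕ → ℕ → List ℕ
interval a b = applyUpTo (a +_) (suc b ∸ a)

primesIn : ℕ → ℕ → List ℕ
primesIn a b = filter prime? (interval a b)

primeDivisorsIn : ℕ → ℕ → ℕ → List ℕ
primeDivisorsIn a b c = filter (λ p → prime? p ×-dec (p ∣? c)) (interval a b)

module Submission where

-- For c = [x^t]A(x) ≠ 0 and N = n + t, let k be the number of primes in the
-- window [t + 1, N³] that divide c and K the number of all primes there.  The
-- theorem (probability k/K = O(1/N)) is proved as N·k ≤ 7·K, by combining:
--
--  * few prime divisors: distinct primes dividing c multiply to a divisor of c,
--    and c ≤ 2^n (A(x) has 2^n monomials), so 2^k ≤ 2^n, i.e. k ≤ n ≤ N;
--  * many primes: Chebyshev's bound 2^Y ≤ Y^(2 + π Y) at Y = N³ ≤ 2^(3N) gives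
--    N³ ≤ 3N·(2 + π(N³)), and at most t ≤ N primes lie below t + 1, so
--    N² ≤ 6·K as soon as N ≥ 8.
--
-- Chebyshev's bound follows from 4^m ≤ (2m+1)·(2m choose m) ≤ (2m+1)·(2m)^π(2m).
-- The second inequality holds because every prime power dividing (2m choose m)
-- is at most 2m; this is a Legendre-type argument, run by induction on the
-- decomposition n! = p^⌊n/p⌋ · ⌊n/p⌋! · R with p ∤ R.

open import Defs
open import Data.Nat using (ℕ; _+_; _*_; _^_; _≤_)
open import Data.List using (length)
open import Data.Vec using (Vec)
open import Data.Vec.Relation.Unary.All using (All)
open import Data.Product using (∃)
open import Relation.Binary.PropositionalEquality using (_≢_)

open import Data.Nat
open import Data.Nat.Properties
open import Data.Nat.Divisibility
open import Data.Nat.DivMod using (m/n*n≡m)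
open import Data.Nat.Primality
open import Data.Nat.Primality.Factorisation using (factorise; factorisationHasAllPrimeFactors)
open import Data.Nat.Combinatorics using (_C_; k![n∸k]!∣n!)
open import Data.Nat.Combinatorics.Specification using (nCk≡n!/k![n-k]!)
open import Data.Nat.ListAction using (product)
open import Data.Nat.Induction using (<-wellFounded)
open import Data.Nat.Tactic.RingSolver using (solve-∀)
open import Induction.WellFounded using (Acc; acc)
open import Data.List using (List; []; _∷_; filter; applyUpTo; _++_)
open import Data.List.Properties using (length-++; filter-++; length-filter; length-applyUpTo)
open import Data.List.Membership.Propositional using (_∈_)
open import Data.List.Membership.Propositional.Properties using (∈-filter⁺; ∈-applyUpTo⁺)
import Data.List.Relation.Unary.All as ListAll
open ListAll using ([]; _∷_)
open import Data.List.Relation.Unary.All.Properties using (all-filter)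
open import Data.List.Relation.Unary.Any using (here; there)
open import Data.List.Relation.Unary.Unique.Propositional using (Unique; []; _∷_)
import Data.List.Relation.Unary.Unique.Propositional.Properties as Unique
open import Data.List.Relation.Binary.Sublist.Propositional using (⊆-refl)
open import Data.List.Relation.Binary.Sublist.Propositional.Properties using (length-mono-≤; filter⁺)
open import Data.Vec using ([]; _∷_)
open import Data.Product
open import Data.Sum using (_⊎_; inj₁; inj₂)
open import Data.Empty using (⊥; ⊥-elim)
open import Relation.Nullary using (¬_; Dec; yes; no; contradiction)
open import Relation.Nullary.Decidable using (_×-dec_)
open import Relation.Binary.PropositionalEquality

prime>1 : ∀ {p} → Prime p → 1 < p
prime>1 {p} p-prime = nonTrivial⇒n>1 p {{prime⇒nonTrivial p-prime}}

primePow∣-cancelʳ : ∀ {p R} → Prime p → ¬ p ∣ R → ∀ k X → p ^ k ∣ X * R → p ^ k ∣ X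
primePow∣-cancelʳ _ _ zero X _ = 1∣ X
primePow∣-cancelʳ {p} {R} p-prime p∤R (suc k) X pᵏ⁺¹∣XR
  with euclidsLemma X R p-prime (∣-trans (m∣m*n (p ^ k)) pᵏ⁺¹∣XR)
... | inj₂ p∣R = ⊥-elim (p∤R p∣R)
... | inj₁ (divides X′ refl) =
  subst (p * p ^ k ∣_) (*-comm p X′)
    (*-monoʳ-∣ p (primePow∣-cancelʳ p-prime p∤R k X′ pᵏ∣X′R))
  where
  reassoc : ∀ a b c → a * b * c ≡ b * (a * c)
  reassoc = solve-∀
  pᵏ∣X′R : p ^ k ∣ X′ * R
  pᵏ∣X′R = *-cancelˡ-∣ p {{prime⇒nonZero p-prime}}
             (subst (p * p ^ k ∣_) (reassoc X′ p R) pᵏ⁺¹∣XR)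

padicSplit : ∀ {p} → 1 < p → ∀ X → 0 < X →
             ∃₂ λ a Y → X ≡ p ^ a * Y × ¬ p ∣ Y × 0 < Y
padicSplit {p} 1<p X = split (<-wellFounded X)
  where
  split : ∀ {X} → Acc _<_ X → 0 < X → ∃₂ λ a Y → X ≡ p ^ a * Y × ¬ p ∣ Y × 0 < Y
  split {X} (acc rec) 0<X with p ∣? X
  ... | no p∤X = 0 , X , sym (+-identityʳ X) , p∤X , 0<X
  ... | yes (divides X′ refl) with split (rec X′<X) 0<X′
    where
    0<X′ : 0 < X′
    0<X′ = >-nonZero⁻¹ X′ {{m*n≢0⇒m≢0 X′ {{>-nonZero 0<X}}}}
    X′<X : X′ < X′ * p
    X′<X = m<m*n X′ p {{>-nonZero 0<X′}} 1<p
  ... | a , Y , refl , p∤Y , 0<Y = suc a , Y , reassoc (p ^ a) Y p , p∤Y , 0<Y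
    where
    reassoc : ∀ u y q → u * y * q ≡ q * u * y
    reassoc = solve-∀

factorials∣ : ∀ {x y z} → x + y ≤ z → x ! * y ! ∣ z !
factorials∣ {x} {y} {z} x+y≤z = ∣-trans x!y!∣[x+y]! (m≤n⇒m!∣n! x+y≤z)
  where
  x!y!∣[x+y]! : x ! * y ! ∣ (x + y) !
  x!y!∣[x+y]! = subst (λ j → x ! * j ! ∣ (x + y) !) (m+n∸m≡n x y) (k![n∸k]!∣n! (m≤m+n x y))

noMultipleBetween : ∀ {p q k} → q * p < k * p → k * p < suc q * p → ⊥
noMultipleBetween {p} {q} {k} qp<kp kp<[1+q]p =
  <-irrefl refl (<-≤-trans (*-cancelʳ-< p k (suc q) kp<[1+q]p) (*-cancelʳ-< p q k qp<kp))

-- The p-part of n!: with q = ⌊n/p⌋ the multiples p, 2p, …, qp of p contribute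
-- p^q · q!, and the remaining factor R is prime to p.
record FactorialSplit (p n : ℕ) : Set where
  field
    q R       : ℕ
    n!≡       : n ! ≡ p ^ q * q ! * R
    p∤R       : ¬ p ∣ R
    q*p≤n     : q * p ≤ n
    n<[1+q]*p : n < suc q * p

-- Every factorial splits, by induction on n: passing from n to n + 1 either
-- hits the next multiple (q + 1)·p, or multiplies R by a number prime to p.
factorialSplit : ∀ {p} → Prime p → ∀ n → FactorialSplit p n
factorialSplit {p} p-prime zero = record
  { q = 0 ; R = 1 ; n!≡ = refl ; p∤R = p∤1 ; q*p≤n = z≤n
  ; n<[1+q]*p = subst (0 <_) (sym (+-identityʳ p)) (<-trans z<s (prime>1 p-prime)) }
  where
  p∤1 : ¬ p ∣ 1
  p∤1 p∣1 = <-irrefl (sym (∣1⇒≡1 p∣1)) (prime>1 p-prime)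
factorialSplit {p} p-prime (suc n) with factorialSplit p-prime n
... | record { q = q ; R = R ; n!≡ = n!≡ ; p∤R = p∤R ; q*p≤n = q*p≤n ; n<[1+q]*p = n<[1+q]*p }
    with suc n ≟ suc q * p
... | yes 1+n≡[1+q]p = record
  { q = suc q ; R = R ; n!≡ = trans (cong₂ _*_ 1+n≡[1+q]p n!≡) (regroup (suc q) p (p ^ q) (q !) R)
  ; p∤R = p∤R ; q*p≤n = ≤-reflexive (sym 1+n≡[1+q]p)
  ; n<[1+q]*p = subst (_< p + suc q * p) (sym 1+n≡[1+q]p)
                  (m<n+m (suc q * p) (<-trans z<s (prime>1 p-prime))) }
  where
  regroup : ∀ a b P F R → a * b * (P * F * R) ≡ b * P * (a * F) * R
  regroup = solve-∀
... | no 1+n≢[1+q]p = record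
  { q = q ; R = suc n * R ; n!≡ = trans (cong (suc n *_) n!≡) (regroup (suc n) (p ^ q) (q !) R)
  ; p∤R = p∤[1+n]R ; q*p≤n = m≤n⇒m≤1+n q*p≤n ; n<[1+q]*p = 1+n<[1+q]p }
  where
  regroup : ∀ a P F R → a * (P * F * R) ≡ P * F * (a * R)
  regroup = solve-∀
  1+n<[1+q]p : suc n < suc q * p
  1+n<[1+q]p = ≤∧≢⇒< n<[1+q]*p 1+n≢[1+q]p
  p∤[1+n]R : ¬ p ∣ suc n * R
  p∤[1+n]R p∣[1+n]R with euclidsLemma (suc n) R p-prime p∣[1+n]R
  ... | inj₂ p∣R = p∤R p∣R
  ... | inj₁ (divides k 1+n≡kp) =
    noMultipleBetween {p} {q} {k} (≤-<-trans q*p≤n (≤-reflexive 1+n≡kp))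
      (subst (_< suc q * p) 1+n≡kp 1+n<[1+q]p)

module PrimePowerBound {p : ℕ} (p-prime : Prime p) where
  open FactorialSplit

  instance
    p≢0 : NonZero p
    p≢0 = prime⇒nonZero p-prime

  quotients-superadditive : ∀ {x y z} (Dx : FactorialSplit p x) (Dy : FactorialSplit p y)
    (Dz : FactorialSplit p z) → x + y ≤ z → q Dx + q Dy ≤ q Dz
  quotients-superadditive {x} {y} {z} Dx Dy Dz x+y≤z = <⇒≤pred (*-cancelʳ-< p _ _ (begin-strict
    (q Dx + q Dy) * p     ≡⟨ *-distribʳ-+ p (q Dx) (q Dy) ⟩
    q Dx * p + q Dy * p   ≤⟨ +-mono-≤ (q*p≤n Dx) (q*p≤n Dy) ⟩
    x + y                 ≤⟨ x+y≤z ⟩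
    z                     <⟨ n<[1+q]*p Dz ⟩
    suc (q Dz) * p        ∎))
    where open ≤-Reasoning

  quotients-subadditive : ∀ {x y z} (Dx : FactorialSplit p x) (Dy : FactorialSplit p y)
    (Dz : FactorialSplit p z) → z ≤ suc (x + y) → q Dz ≤ suc (q Dx + q Dy)
  quotients-subadditive {x} {y} {z} Dx Dy Dz z≤1+x+y = <⇒≤pred (*-cancelʳ-< p _ _ (begin-strict
    q Dz * p                          ≤⟨ q*p≤n Dz ⟩
    z                                 ≤⟨ z≤1+x+y ⟩
    suc (x + y)                       <⟨ ≤-reflexive (cong suc (sym (+-suc x y))) ⟩
    suc x + suc y                     ≤⟨ +-mono-≤ (n<[1+q]*p Dx) (n<[1+q]*p Dy) ⟩
    suc (q Dx) * p + suc (q Dy) * p   ≡⟨ sym (*-distribʳ-+ p (suc (q Dx)) (suc (q Dy))) ⟩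
    (suc (q Dx) + suc (q Dy)) * p     ≡⟨ cong (λ w → suc w * p) (+-suc (q Dx) (q Dy)) ⟩
    suc (suc (q Dx + q Dy)) * p       ∎))
    where open ≤-Reasoning

  descent : ∀ {x y z W W′} (Dx : FactorialSplit p x) (Dy : FactorialSplit p y)
    (Dz : FactorialSplit p z) → W * (x ! * y !) ≡ z ! → W′ * (q Dx ! * q Dy !) ≡ q Dz ! →
    ∀ d → q Dz ≡ q Dx + q Dy + d → W * R Dx * R Dy ≡ p ^ d * W′ * R Dz
  descent {x} {y} {z} {W} {W′} Dx Dy Dz eqW eqW′ d qz≡ = *-cancelʳ-≡ _ _ P (begin
    W * Rx * Ry * P
      ≡⟨ regroupˡ W (p ^ qx) (qx !) Rx (p ^ qy) (qy !) Ry ⟩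
    W * (p ^ qx * qx ! * Rx * (p ^ qy * qy ! * Ry))
      ≡⟨ cong (W *_) (sym (cong₂ _*_ (n!≡ Dx) (n!≡ Dy))) ⟩
    W * (x ! * y !)
      ≡⟨ trans eqW (n!≡ Dz) ⟩
    p ^ q Dz * q Dz ! * Rz
      ≡⟨ cong₂ (λ e f → p ^ e * f * Rz) qz≡ (sym eqW′) ⟩
    p ^ (qx + qy + d) * (W′ * (qx ! * qy !)) * Rz
      ≡⟨ cong (λ e → e * (W′ * (qx ! * qy !)) * Rz) powers ⟩
    p ^ qx * p ^ qy * p ^ d * (W′ * (qx ! * qy !)) * Rz
      ≡⟨ regroupʳ (p ^ qx) (p ^ qy) (p ^ d) W′ (qx !) (qy !) Rz ⟩
    p ^ d * W′ * Rz * P ∎)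
    where
    open ≡-Reasoning
    qx = q Dx
    qy = q Dy
    Rx = R Dx
    Ry = R Dy
    Rz = R Dz
    P = p ^ qx * p ^ qy * (qx ! * qy !)
    instance
      P≢0 : NonZero P
      P≢0 = m*n≢0 _ _ {{m*n≢0 _ _ {{m^n≢0 p qx}} {{m^n≢0 p qy}}}} {{_!*_!≢0 qx qy}}
    powers : p ^ (qx + qy + d) ≡ p ^ qx * p ^ qy * p ^ d
    powers = trans (^-distribˡ-+-* p (qx + qy) d) (cong (_* p ^ d) (^-distribˡ-+-* p qx qy))
    regroupˡ : ∀ w a b c d e f → w * c * f * (a * d * (b * e)) ≡ w * (a * b * c * (d * e * f))
    regroupˡ = solve-∀
    regroupʳ : ∀ a b c w f g r → a * b * c * (w * (f * g)) * r ≡ c * w * r * (a * b * (f * g))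
    regroupʳ = solve-∀

  descent-∣ : ∀ {x y z W W′} (Dx : FactorialSplit p x) (Dy : FactorialSplit p y)
    (Dz : FactorialSplit p z) → W * (x ! * y !) ≡ z ! → W′ * (q Dx ! * q Dy !) ≡ q Dz ! →
    ∀ d → q Dz ≡ q Dx + q Dy + d → ∀ k → p ^ k ∣ W → p ^ k ∣ p ^ d * W′
  descent-∣ {W = W} {W′} Dx Dy Dz eqW eqW′ d qz≡ k pᵏ∣W =
    primePow∣-cancelʳ p-prime (p∤R Dz) k (p ^ d * W′)
      (subst (p ^ k ∣_) (descent {W = W} Dx Dy Dz eqW eqW′ d qz≡)
        (∣m⇒∣m*n (R Dy) (∣m⇒∣m*n (R Dx) pᵏ∣W)))

  p*quotient≤ : ∀ {z} (Dz : FactorialSplit p z) → p * q Dz ≤ z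
  p*quotient≤ {z} Dz = subst (_≤ z) (*-comm (q Dz) p) (q*p≤n Dz)

  quotient< : ∀ {z} (Dz : FactorialSplit p z) → 0 < z → q Dz < z
  quotient< {z} Dz 0<z with q Dz in qz≡
  ... | zero  = 0<z
  ... | suc _ = <-≤-trans (m<m*n _ p (prime>1 p-prime)) (subst (λ j → j * p ≤ z) qz≡ (q*p≤n Dz))

  squeeze : ∀ {s n} → s ≤ n → n ≤ suc s → n ≡ s ⊎ n ≡ suc s
  squeeze s≤n n≤1+s with m≤n⇒m<n∨m≡n n≤1+s
  ... | inj₁ n<1+s = inj₁ (≤-antisym (<⇒≤pred n<1+s) s≤n)
  ... | inj₂ n≡1+s = inj₂ n≡1+s

  primePow∤1 : ∀ a → ¬ p ^ suc a ∣ 1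
  primePow∤1 a pᵃ⁺¹∣1 = <-irrefl (sym (∣1⇒≡1 pᵃ⁺¹∣1))
    (<-≤-trans (prime>1 p-prime) (m≤m*n p (p ^ a) {{m^n≢0 p a}}))

  -- Induction on z: passing to the
  -- quotients ⌊·/p⌋ gives the same situation for W′ = ⌊z/p⌋!/(⌊x/p⌋!·⌊y/p⌋!),
  -- and W differs from W′ by at most one factor p.
  primePowerBound : ∀ {x y z W} → W * (x ! * y !) ≡ z ! → x + y ≤ z → z ≤ suc (x + y) →
                    ∀ a → p ^ suc a ∣ W → p ^ suc a ≤ z
  primePowerBound {x} {y} {z} = bound {x} {y} (<-wellFounded z)
    where
    bound : ∀ {x y z W} → Acc _<_ z → W * (x ! * y !) ≡ z ! → x + y ≤ z → z ≤ suc (x + y) →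
            ∀ a → p ^ suc a ∣ W → p ^ suc a ≤ z
    bound {x} {y} {zero} {W} _ eqW _ _ a pᵃ⁺¹∣W =
      ⊥-elim (primePow∤1 a (∣-trans pᵃ⁺¹∣W (divides (x ! * y !) (trans (sym eqW) (*-comm W _)))))
    bound {x} {y} {z@(suc _)} {W} (acc rec) eqW x+y≤z z≤1+x+y a pᵃ⁺¹∣W =
      conclude (squeeze s≤qz qz≤1+s)
      where
      Dx : FactorialSplit p x
      Dx = factorialSplit p-prime x
      Dy : FactorialSplit p y
      Dy = factorialSplit p-prime y
      Dz : FactorialSplit p z
      Dz = factorialSplit p-prime z
      s : ℕ
      s = q Dx + q Dy
      s≤qz : s ≤ q Dz
      s≤qz = quotients-superadditive Dx Dy Dz x+y≤z
      qz≤1+s : q Dz ≤ suc s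
      qz≤1+s = quotients-subadditive Dx Dy Dz z≤1+x+y
      qx!qy!∣qz! : q Dx ! * q Dy ! ∣ q Dz !
      qx!qy!∣qz! = factorials∣ {q Dx} {q Dy} s≤qz
      W′ : ℕ
      W′ = quotient qx!qy!∣qz!
      eqW′ : W′ * (q Dx ! * q Dy !) ≡ q Dz !
      eqW′ = sym (m∣n⇒n≡quotient*m qx!qy!∣qz!)
      IH : ∀ b → p ^ suc b ∣ W′ → p ^ suc b ≤ q Dz
      IH = bound {q Dx} {q Dy} (rec (quotient< Dz z<s)) eqW′ s≤qz qz≤1+s
      pᵃ⁺¹∣pᵈW′ : ∀ d → q Dz ≡ s + d → p ^ suc a ∣ p ^ d * W′
      pᵃ⁺¹∣pᵈW′ d qz≡s+d = descent-∣ {W = W} Dx Dy Dz eqW eqW′ d qz≡s+d (suc a) pᵃ⁺¹∣W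
      conclude : q Dz ≡ s ⊎ q Dz ≡ suc s → p ^ suc a ≤ z
      conclude (inj₁ qz≡s) = ≤-trans (IH a pᵃ⁺¹∣W′) (≤-trans (m≤n*m (q Dz) p) (p*quotient≤ Dz))
        where
        pᵃ⁺¹∣W′ : p ^ suc a ∣ W′
        pᵃ⁺¹∣W′ = subst (p ^ suc a ∣_) (*-identityˡ W′)
                    (pᵃ⁺¹∣pᵈW′ 0 (trans qz≡s (sym (+-identityʳ s))))
      conclude (inj₂ qz≡1+s) = multiply a (*-cancelˡ-∣ p pᵃ⁺¹∣pW′)
        where
        pᵃ⁺¹∣pW′ : p * p ^ a ∣ p * W′
        pᵃ⁺¹∣pW′ = subst (p ^ suc a ∣_) (cong (_* W′) (*-identityʳ p))
                     (pᵃ⁺¹∣pᵈW′ 1 (trans qz≡1+s (+-comm 1 s)))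
        multiply : ∀ b → p ^ b ∣ W′ → p ^ suc b ≤ z
        multiply zero _ = ≤-trans (*-monoʳ-≤ p (subst (1 ≤_) (sym qz≡1+s) (s≤s z≤n))) (p*quotient≤ Dz)
        multiply (suc b) pᵇ∣W′ = ≤-trans (*-monoʳ-≤ p (IH b pᵇ∣W′)) (p*quotient≤ Dz)

nCk*k![n∸k]!≡n! : ∀ {n k} → k ≤ n → (n C k) * (k ! * (n ∸ k) !) ≡ n !
nCk*k![n∸k]!≡n! {n} {k} k≤n =
  trans (cong (_* (k ! * (n ∸ k) !)) (nCk≡n!/k![n-k]! k≤n))
        (m/n*n≡m {{_!*_!≢0 k (n ∸ k)}} (k![n∸k]!∣n! k≤n))

central : ℕ → ℕ
central m = (m + m) C m

central-factorials : ∀ m → central m * (m ! * m !) ≡ (m + m) !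
central-factorials m = subst (λ j → central m * (m ! * j !) ≡ (m + m) !)
  (m+n∸m≡n m m) (nCk*k![n∸k]!≡n! (m≤m+n m m))

central>0 : ∀ m → 0 < central m
central>0 m with central m | central-factorials m
... | zero  | 0≡[2m]! = ⊥-elim (≢-nonZero⁻¹ ((m + m) !) {{(m + m) !≢0}} (sym 0≡[2m]!))
... | suc _ | _ = z<s

central-step : ∀ m → central (suc m) * suc m ≡ 2 * suc (m + m) * central m
central-step m = *-cancelʳ-≡ _ _ (suc m * (m ! * m !)) (begin
  central (suc m) * suc m * (suc m * (m ! * m !))
    ≡⟨ regroupˡ (central (suc m)) (suc m) (m !) ⟩
  central (suc m) * (suc m ! * suc m !)
    ≡⟨ central-factorials (suc m) ⟩
  (suc m + suc m) !
    ≡⟨ cong _! (cong suc (+-suc m m)) ⟩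
  (2 + M) * ((1 + M) * M !)
    ≡⟨ cong (λ f → (2 + M) * ((1 + M) * f)) (sym (central-factorials m)) ⟩
  (2 + M) * ((1 + M) * (central m * (m ! * m !)))
    ≡⟨ regroupʳ m (m !) (central m) ⟩
  2 * suc M * central m * (suc m * (m ! * m !)) ∎)
  where
  open ≡-Reasoning
  M = m + m
  instance
    [1+m]m!m!≢0 : NonZero (suc m * (m ! * m !))
    [1+m]m!m!≢0 = m*n≢0 (suc m) (m ! * m !) {{_}} {{_!*_!≢0 m m}}
  regroupˡ : ∀ c s f → c * s * (s * (f * f)) ≡ c * (s * f * (s * f))
  regroupˡ = solve-∀
  regroupʳ : ∀ m f b → (2 + (m + m)) * ((1 + (m + m)) * (b * (f * f)))
                     ≡ 2 * (1 + (m + m)) * b * ((1 + m) * (f * f))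
  regroupʳ = solve-∀

4^m≤[2m+1]*central : ∀ m → 4 ^ m ≤ suc (m + m) * central m
4^m≤[2m+1]*central zero = ≤-refl
4^m≤[2m+1]*central (suc m) = *-cancelˡ-≤ (suc m) (begin
  suc m * (4 * 4 ^ m)
    ≡⟨ x*[4y]≡[4x]*y (suc m) (4 ^ m) ⟩
  (4 * suc m) * 4 ^ m
    ≤⟨ *-monoʳ-≤ (4 * suc m) (4^m≤[2m+1]*central m) ⟩
  (4 * suc m) * (suc M * central m)
    ≡⟨ regroup m (central m) ⟩
  (2 + M) * (2 * suc M * central m)
    ≤⟨ *-monoˡ-≤ (2 * suc M * central m) (n≤1+n (2 + M)) ⟩
  (3 + M) * (2 * suc M * central m)
    ≡⟨ cong (λ j → suc j * (2 * suc M * central m)) (cong suc (sym (+-suc m m))) ⟩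
  suc (suc m + suc m) * (2 * suc M * central m)
    ≡⟨ cong (suc (suc m + suc m) *_) (sym (central-step m)) ⟩
  suc (suc m + suc m) * (central (suc m) * suc m)
    ≡⟨ rotate (suc (suc m + suc m)) (central (suc m)) (suc m) ⟩
  suc m * (suc (suc m + suc m) * central (suc m)) ∎)
  where
  open ≤-Reasoning
  M = m + m
  x*[4y]≡[4x]*y : ∀ x y → x * (4 * y) ≡ (4 * x) * y
  x*[4y]≡[4x]*y = solve-∀
  regroup : ∀ m b → 4 * (1 + m) * ((1 + (m + m)) * b) ≡ (2 + (m + m)) * (2 * (1 + (m + m)) * b)
  regroup = solve-∀
  rotate : ∀ a b c → a * (b * c) ≡ c * (a * b)
  rotate = solve-∀

noPrimeFactor⇒≤1 : ∀ X → 0 < X → (∀ {q} → Prime q → ¬ q ∣ X) → X ≤ 1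
noPrimeFactor⇒≤1 X 0<X noFactor with factorise X {{>-nonZero 0<X}}
... | record { factors = [] ; isFactorisation = X≡1 } = ≤-reflexive X≡1
... | record { factors = q ∷ qs ; isFactorisation = X≡qΠ ; factorsPrime = q-prime ∷ _ } =
  ⊥-elim (noFactor q-prime (divides (product qs) (trans X≡qΠ (*-comm q _))))

-- If every prime factor of X > 0 lies in Ps and every prime power dividing X
-- is at most M, then X ≤ M ^ |Ps|: split off the full p-power of X, which is
-- at most M, for each p ∈ Ps in turn.
smoothBound : ∀ {M} → 1 ≤ M → (Ps : List ℕ) → ∀ X → 0 < X →
  (∀ {q} → Prime q → q ∣ X → q ∈ Ps) →
  (∀ {q} a → Prime q → q ^ suc a ∣ X → q ^ suc a ≤ M) → X ≤ M ^ length Ps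
smoothBound 1≤M [] X 0<X factor∈ _ =
  noPrimeFactor⇒≤1 X 0<X (λ q-prime q∣X → ∉[] (factor∈ q-prime q∣X))
  where
  ∉[] : ∀ {q} → ¬ q ∈ []
  ∉[] ()
smoothBound {M} 1≤M (p ∷ Ps) X 0<X factor∈ powers≤M with prime? p
... | no ¬p-prime =
  ≤-trans (smoothBound 1≤M Ps X 0<X factor∈Ps powers≤M) (m≤n*m (M ^ length Ps) M {{>-nonZero 1≤M}})
  where
  factor∈Ps : ∀ {q} → Prime q → q ∣ X → q ∈ Ps
  factor∈Ps q-prime q∣X with factor∈ q-prime q∣X
  ... | here refl = ⊥-elim (¬p-prime q-prime)
  ... | there q∈Ps = q∈Ps
... | yes p-prime with padicSplit (prime>1 p-prime) X 0<X
... | a , Y , refl , p∤Y , 0<Y =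
  *-mono-≤ (pᵃ≤M a (∣m⇒∣m*n Y ∣-refl)) (smoothBound 1≤M Ps Y 0<Y factor∈Ps powers≤M′)
  where
  ∣Y⇒∣X : ∀ {d} → d ∣ Y → d ∣ p ^ a * Y
  ∣Y⇒∣X = ∣n⇒∣m*n (p ^ a)
  factor∈Ps : ∀ {q} → Prime q → q ∣ Y → q ∈ Ps
  factor∈Ps q-prime q∣Y with factor∈ q-prime (∣Y⇒∣X q∣Y)
  ... | here refl = ⊥-elim (p∤Y q∣Y)
  ... | there q∈Ps = q∈Ps
  powers≤M′ : ∀ {q} b → Prime q → q ^ suc b ∣ Y → q ^ suc b ≤ M
  powers≤M′ b q-prime qᵇ⁺¹∣Y = powers≤M b q-prime (∣Y⇒∣X qᵇ⁺¹∣Y)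
  pᵃ≤M : ∀ b → p ^ b ∣ p ^ a * Y → p ^ b ≤ M
  pᵃ≤M zero _ = 1≤M
  pᵃ≤M (suc b) pᵇ⁺¹∣X = powers≤M b p-prime pᵇ⁺¹∣X

applyUpTo-++ : ∀ (f : ℕ → ℕ) m n →
  applyUpTo f (m + n) ≡ applyUpTo f m ++ applyUpTo (λ i → f (m + i)) n
applyUpTo-++ f zero n = refl
applyUpTo-++ f (suc m) n = cong (f 0 ∷_) (applyUpTo-++ (λ i → f (suc i)) m n)

applyUpTo-cong : ∀ {f g : ℕ → ℕ} → (∀ i → f i ≡ g i) → ∀ n → applyUpTo f n ≡ applyUpTo g n
applyUpTo-cong f≗g zero = refl
applyUpTo-cong f≗g (suc n) = cong₂ _∷_ (f≗g 0) (applyUpTo-cong (λ i → f≗g (suc i)) n)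

interval-++ : ∀ {a b c} → a ≤ suc b → b ≤ c → interval a c ≡ interval a b ++ interval (suc b) c
interval-++ {a} {b} {c} a≤1+b b≤c = begin
  applyUpTo (a +_) (suc c ∸ a)
    ≡⟨ cong (λ j → applyUpTo (a +_) (j ∸ a)) (cong suc (sym (m+[n∸m]≡n b≤c))) ⟩
  applyUpTo (a +_) (suc b + (c ∸ b) ∸ a)
    ≡⟨ cong (applyUpTo (a +_)) (+-∸-comm (c ∸ b) a≤1+b) ⟩
  applyUpTo (a +_) (l + (c ∸ b))
    ≡⟨ applyUpTo-++ (a +_) l (c ∸ b) ⟩
  interval a b ++ applyUpTo (λ i → a + (l + i)) (c ∸ b)
    ≡⟨ cong (interval a b ++_) (applyUpTo-cong shift (c ∸ b)) ⟩
  interval a b ++ interval (suc b) c ∎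
  where
  open ≡-Reasoning
  l = suc b ∸ a
  shift : ∀ i → a + (l + i) ≡ suc b + i
  shift i = trans (sym (+-assoc a l i)) (cong (_+ i) (m+[n∸m]≡n a≤1+b))

primesIn-++ : ∀ {a b c} → a ≤ suc b → b ≤ c →
  length (primesIn a c) ≡ length (primesIn a b) + length (primesIn (suc b) c)
primesIn-++ {a} {b} {c} a≤1+b b≤c = begin
  length (filter prime? (interval a c))
    ≡⟨ cong (λ xs → length (filter prime? xs)) (interval-++ a≤1+b b≤c) ⟩
  length (filter prime? (interval a b ++ interval (suc b) c))
    ≡⟨ cong length (filter-++ prime? (interval a b) (interval (suc b) c)) ⟩
  length (primesIn a b ++ primesIn (suc b) c)
    ≡⟨ length-++ (primesIn a b) ⟩
  length (primesIn a b) + length (primesIn (suc b) c) ∎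
  where open ≡-Reasoning

π : ℕ → ℕ
π Y = length (primesIn 1 Y)

π-mono : ∀ {b c} → b ≤ c → π b ≤ π c
π-mono {b} {c} b≤c = subst (π b ≤_) (sym (primesIn-++ (s≤s z≤n) b≤c)) (m≤m+n (π b) _)

π[n]≤n : ∀ n → π n ≤ n
π[n]≤n n = ≤-trans (length-filter prime? (interval 1 n)) (≤-reflexive (length-applyUpTo (1 +_) n))

-- A prime q ≤ Y is counted by π Y (there is no clause for q = 0, which is not prime).
prime∈primesIn : ∀ {q Y} → Prime q → q ≤ Y → q ∈ primesIn 1 Y
prime∈primesIn {suc q′} q-prime q≤Y = ∈-filter⁺ prime? (∈-applyUpTo⁺ (1 +_) q≤Y) q-prime

central-primePower≤ : ∀ m {q} a → Prime q → q ^ suc a ∣ central m → q ^ suc a ≤ m + m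
central-primePower≤ m a q-prime =
  PrimePowerBound.primePowerBound q-prime {m} {m} (central-factorials m) ≤-refl (n≤1+n (m + m)) a

central≤ : ∀ m → 1 ≤ m → central m ≤ (m + m) ^ π (m + m)
central≤ m 1≤m = smoothBound (≤-trans 1≤m (m≤m+n m m)) (primesIn 1 (m + m))
  (central m) (central>0 m) factor∈ (central-primePower≤ m)
  where
  factor∈ : ∀ {q} → Prime q → q ∣ central m → q ∈ primesIn 1 (m + m)
  factor∈ {q} q-prime q∣central = prime∈primesIn q-prime
    (subst (_≤ m + m) (*-identityʳ q)
      (central-primePower≤ m 0 q-prime (subst (_∣ central m) (sym (*-identityʳ q)) q∣central)))

even-or-odd : ∀ Y → ∃ λ m → Y ≡ m + m ⊎ Y ≡ suc (m + m)
even-or-odd zero = 0 , inj₁ refl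
even-or-odd (suc Y) with even-or-odd Y
... | m , inj₁ refl = m , inj₂ refl
... | m , inj₂ refl = suc m , inj₁ (cong suc (sym (+-suc m m)))

2^[m+m]≡4^m : ∀ m → 2 ^ (m + m) ≡ 4 ^ m
2^[m+m]≡4^m m = trans (cong (λ j → 2 ^ (m + j)) (sym (+-identityʳ m))) (sym (^-*-assoc 2 2 m))

1+n≤n*n : ∀ {n} → 2 ≤ n → suc n ≤ n * n
1+n≤n*n {n} 2≤n = begin
  suc n       ≡⟨ +-comm 1 n ⟩
  n + 1       ≤⟨ +-monoʳ-≤ n (≤-trans (s≤s z≤n) 2≤n) ⟩
  n + n       ≡⟨ cong (n +_) (sym (+-identityʳ n)) ⟩
  2 * n       ≤⟨ *-monoˡ-≤ n 2≤n ⟩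
  n * n       ∎
  where open ≤-Reasoning

-- Chebyshev's lower bound in multiplicative form: 2^Y ≤ Y^(2 + π Y) for Y ≥ 2.
-- For Y = 2m it is 4^m ≤ (2m + 1)·(2m choose m) ≤ Y²·Y^π(Y); the odd case
-- Y = 2m + 1 reduces to the even one.
chebyshev : ∀ Y → 2 ≤ Y → 2 ^ Y ≤ Y ^ (2 + π Y)
chebyshev Y 2≤Y with even-or-odd Y
... | zero , inj₁ refl = contradiction 2≤Y λ ()
... | zero , inj₂ refl = contradiction 2≤Y λ { (s≤s ()) }
... | m@(suc _) , inj₁ refl = begin
  2 ^ (m + m)                              ≡⟨ 2^[m+m]≡4^m m ⟩
  4 ^ m                                    ≤⟨ 4^m≤[2m+1]*central m ⟩
  suc (m + m) * central m                  ≤⟨ *-mono-≤ (1+n≤n*n 2≤Y) (central≤ m (s≤s z≤n)) ⟩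
  (m + m) * (m + m) * (m + m) ^ π (m + m)  ≡⟨ *-assoc (m + m) (m + m) _ ⟩
  (m + m) ^ (2 + π (m + m))                ∎
  where open ≤-Reasoning
... | m@(suc _) , inj₂ refl = begin
  2 * 2 ^ (m + m)
    ≡⟨ cong (2 *_) (2^[m+m]≡4^m m) ⟩
  2 * 4 ^ m
    ≤⟨ *-monoʳ-≤ 2 (4^m≤[2m+1]*central m) ⟩
  2 * (Y′ * central m)
    ≤⟨ *-mono-≤ 2≤Y (*-monoʳ-≤ Y′ (central≤ m (s≤s z≤n))) ⟩
  Y′ * (Y′ * (m + m) ^ π (m + m))
    ≤⟨ *-monoʳ-≤ Y′ (*-monoʳ-≤ Y′ (^-monoˡ-≤ (π (m + m)) (n≤1+n (m + m)))) ⟩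
  Y′ * (Y′ * Y′ ^ π (m + m))
    ≤⟨ *-monoʳ-≤ Y′ (*-monoʳ-≤ Y′ (^-monoʳ-≤ Y′ (π-mono (n≤1+n (m + m))))) ⟩
  Y′ ^ (2 + π Y′) ∎
  where
  open ≤-Reasoning
  Y′ = suc (m + m)

2^-reflects-≤ : ∀ {m n} → 2 ^ m ≤ 2 ^ n → m ≤ n
2^-reflects-≤ 2ᵐ≤2ⁿ = ≮⇒≥ (λ n<m → <⇒≱ (^-monoʳ-< 2 (s≤s (s≤s z≤n)) n<m) 2ᵐ≤2ⁿ)

chebyshev-log : ∀ {Y} E → 2 ≤ Y → Y ≤ 2 ^ E → Y ≤ E * (2 + π Y)
chebyshev-log {Y} E 2≤Y Y≤2^E = 2^-reflects-≤ (begin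
  2 ^ Y                 ≤⟨ chebyshev Y 2≤Y ⟩
  Y ^ (2 + π Y)         ≤⟨ ^-monoˡ-≤ (2 + π Y) Y≤2^E ⟩
  (2 ^ E) ^ (2 + π Y)   ≡⟨ ^-*-assoc 2 E (2 + π Y) ⟩
  2 ^ (E * (2 + π Y))   ∎)
  where open ≤-Reasoning

product-distinctPrimes∣ : ∀ {c ps} → Unique ps → ListAll.All (λ p → Prime p × p ∣ c) ps →
                          product ps ∣ c
product-distinctPrimes∣ {c} [] [] = 1∣ c
product-distinctPrimes∣ {c} {p ∷ ps} (p∉ps ∷ unique) ((p-prime , p∣c) ∷ primeDivisors)
  with product-distinctPrimes∣ unique primeDivisors
... | divides r c≡rΠ with euclidsLemma r (product ps) p-prime (subst (p ∣_) c≡rΠ p∣c)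
...   | inj₂ p∣Π = ⊥-elim (ListAll.lookup p∉ps p∈ps refl)
  where
  p∈ps : p ∈ ps
  p∈ps = factorisationHasAllPrimeFactors p-prime p∣Π (ListAll.map proj₁ primeDivisors)
...   | inj₁ (divides s r≡sp) =
  divides s (trans c≡rΠ (trans (cong (_* product ps) r≡sp) (*-assoc s p (product ps))))

2^length≤product : ∀ {ps} → ListAll.All Prime ps → 2 ^ length ps ≤ product ps
2^length≤product [] = ≤-refl
2^length≤product (p-prime ∷ primes) = *-mono-≤ (prime>1 p-prime) (2^length≤product primes)

primeDivisorsIn-bound : ∀ a b {c} → c ≢ 0 → 2 ^ length (primeDivisorsIn a b c) ≤ c
primeDivisorsIn-bound a b {c} c≢0 = begin
  2 ^ length divisors   ≤⟨ 2^length≤product (ListAll.map proj₁ divides-c) ⟩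
  product divisors      ≤⟨ ∣⇒≤ {{≢-nonZero c≢0}} (product-distinctPrimes∣ unique divides-c) ⟩
  c                     ∎
  where
  open ≤-Reasoning
  isPrimeDivisor? : (p : ℕ) → Dec (Prime p × p ∣ c)
  isPrimeDivisor? p = prime? p ×-dec (p ∣? c)
  divisors : List ℕ
  divisors = primeDivisorsIn a b c
  unique : Unique divisors
  unique = Unique.filter⁺ isPrimeDivisor?
    (Unique.applyUpTo⁺₁ (a +_) (suc b ∸ a) (λ i<j _ a+i≡a+j → <⇒≢ i<j (+-cancelˡ-≡ a _ _ a+i≡a+j)))
  divides-c : ListAll.All (λ p → Prime p × p ∣ c) divisors
  divides-c = all-filter isPrimeDivisor? (interval a b)

primeDivisorsIn≤primesIn : ∀ a b c → length (primeDivisorsIn a b c) ≤ length (primesIn a b)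
primeDivisorsIn≤primesIn a b c = length-mono-≤
  (filter⁺ (λ p → prime? p ×-dec (p ∣? c)) prime? (λ { refl (p-prime , _) → p-prime })
    (⊆-refl {x = interval a b}))

-- [x^t] ∏ (1 + x^sᵢ) ≤ 2^n: the product has 2^n terms in total.
coeffA≤2^n : ∀ {n} (s : Vec ℕ n) t → coeffA s t ≤ 2 ^ n
coeffA≤2^n [] zero = ≤-refl
coeffA≤2^n [] (suc t) = z≤n
coeffA≤2^n {suc n} (sᵢ ∷ s) t with sᵢ ≤? t
... | yes _ = ≤-trans (+-mono-≤ (coeffA≤2^n s t) (coeffA≤2^n s (t ∸ sᵢ)))
                      (≤-reflexive (cong (2 ^ n +_) (sym (+-identityʳ (2 ^ n)))))
... | no _ = ≤-trans (coeffA≤2^n s t) (m≤m+n (2 ^ n) _)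

n<2^n : ∀ n → n < 2 ^ n
n<2^n zero = z<s
n<2^n (suc n) = begin-strict
  suc n                 ≡⟨ +-comm 1 n ⟩
  n + 1                 <⟨ +-mono-<-≤ (n<2^n n) (m^n>0 2 n) ⟩
  2 ^ n + 2 ^ n         ≡⟨ cong (2 ^ n +_) (sym (+-identityʳ (2 ^ n))) ⟩
  2 ^ suc n             ∎
  where open ≤-Reasoning

square-absorb : ∀ {N K} → 8 ≤ N → N * N ≤ 3 * (2 + N + K) → N * N ≤ 6 * K
square-absorb {N} {K} 8≤N N²≤ with m≤n⇒∃[o]m+o≡n 8≤N
... | r , refl = ≤-trans (m≤m+n (N * N) D) (+-cancelˡ-≤ (12 + 6 * N) _ _ (begin
  (12 + 6 * N) + (N * N + D)   ≡⟨ twice-square r ⟩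
  2 * (N * N)                  ≤⟨ *-monoʳ-≤ 2 N²≤ ⟩
  2 * (3 * (2 + N + K))        ≡⟨ twice-bound r K ⟩
  (12 + 6 * N) + 6 * K         ∎))
  where
  open ≤-Reasoning
  D = 4 + 10 * r + r * r
  twice-square : ∀ r → (12 + 6 * (8 + r)) + ((8 + r) * (8 + r) + (4 + 10 * r + r * r))
                       ≡ 2 * ((8 + r) * (8 + r))
  twice-square = solve-∀
  twice-bound : ∀ r K → 2 * (3 * (2 + (8 + r) + K)) ≡ (12 + 6 * (8 + r)) + 6 * K
  twice-bound = solve-∀

-- For N ≥ 8 and t ≤ N the window [t + 1, N³] contains at least N²/6 primes:
-- Chebyshev gives N³ ≤ 3N·(2 + π(N³)), and at most t ≤ N of those primes lie below t + 1.
manyPrimesInWindow : ∀ {N t} → 8 ≤ N → t ≤ N → N * N ≤ 6 * length (primesIn (t + 1) (N ^ 3))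
manyPrimesInWindow {N} {t} 8≤N t≤N = square-absorb 8≤N (*-cancelˡ-≤ N (begin
  N * (N * N)                  ≡⟨ cong (λ j → N * (N * j)) (sym (*-identityʳ N)) ⟩
  X                            ≤⟨ chebyshev-log (N * 3) 2≤X X≤2^[3N] ⟩
  N * 3 * (2 + π X)            ≤⟨ *-monoʳ-≤ (N * 3) (+-monoʳ-≤ 2 πX≤N+K) ⟩
  N * 3 * (2 + (N + K))        ≡⟨ regroup N K ⟩
  N * (3 * (2 + N + K))        ∎))
  where
  open ≤-Reasoning
  instance
    N≢0 : NonZero N
    N≢0 = >-nonZero (≤-trans (s≤s z≤n) 8≤N)
  X = N ^ 3
  K = length (primesIn (t + 1) X)
  N≤X : N ≤ X
  N≤X = m≤m*n N (N * (N * 1)) {{m^n≢0 N 2}}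
  2≤X : 2 ≤ X
  2≤X = ≤-trans (≤-trans (s≤s (s≤s z≤n)) 8≤N) N≤X
  X≤2^[3N] : X ≤ 2 ^ (N * 3)
  X≤2^[3N] = ≤-trans (^-monoˡ-≤ 3 (<⇒≤ (n<2^n N))) (≤-reflexive (^-*-assoc 2 N 3))
  πX≤N+K : π X ≤ N + K
  πX≤N+K = begin
    π X                                        ≡⟨ primesIn-++ (s≤s z≤n) (≤-trans t≤N N≤X) ⟩
    π t + length (primesIn (suc t) X)          ≡⟨ cong (λ j → π t + length (primesIn j X)) (+-comm 1 t) ⟩
    π t + K                                    ≤⟨ +-monoˡ-≤ K (≤-trans (π[n]≤n t) t≤N) ⟩
    N + K                                      ∎
  regroup : ∀ N K → N * 3 * (2 + (N + K)) ≡ N * (3 * (2 + N + K))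
  regroup = solve-∀

-- The theorem with C = 7: for N = n + t ≤ 7 it is k ≤ K, otherwise N·k ≤ N·N ≤ 6K
-- since k ≤ n.
lemma3 : ∃ λ (C : ℕ) →
    (n t : ℕ) → 1 ≤ n → 1 ≤ t →
    (s : Vec ℕ n) → All (λ sᵢ → 1 ≤ sᵢ) s →
    coeffA s t ≢ 0 →
    (n + t) * length (primeDivisorsIn (t + 1) ((n + t) ^ 3) (coeffA s t))
      ≤ C * length (primesIn (t + 1) ((n + t) ^ 3))
lemma3 = 7 , bound
  where
  bound : (n t : ℕ) → 1 ≤ n → 1 ≤ t → (s : Vec ℕ n) → All (λ sᵢ → 1 ≤ sᵢ) s → coeffA s t ≢ 0 →
    (n + t) * length (primeDivisorsIn (t + 1) ((n + t) ^ 3) (coeffA s t))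
      ≤ 7 * length (primesIn (t + 1) ((n + t) ^ 3))
  bound n t _ _ s _ c≢0 with n + t ≤? 7
  ... | yes N≤7 = *-mono-≤ N≤7 (primeDivisorsIn≤primesIn (t + 1) ((n + t) ^ 3) (coeffA s t))
  ... | no N≰7 = begin
    N * k         ≤⟨ *-monoʳ-≤ N (≤-trans k≤n (m≤m+n n t)) ⟩
    N * N         ≤⟨ manyPrimesInWindow (≰⇒> N≰7) (m≤n+m t n) ⟩
    6 * K         ≤⟨ *-monoˡ-≤ K (n≤1+n 6) ⟩
    7 * K         ∎
    where
    open ≤-Reasoning
    N = n + t
    k = length (primeDivisorsIn (t + 1) (N ^ 3) (coeffA s t))
    K = length (primesIn (t + 1) (N ^ 3))
    -- 2^k ≤ [x^t]A(x) ≤ 2^n.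
    k≤n : k ≤ n
    k≤n = 2^-reflects-≤ (≤-trans (primeDivisorsIn-bound (t + 1) (N ^ 3) c≢0) (coeffA≤2^n s t))
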